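{- Let $a_1,b_1,a_2,b_2,d_1,d_2$ be complex numbers, $c_1,c_2$ nonzero complex numbers, $p_1,p_2$ non-negative integers, $k$ an integer with $0\le k\le p_1+p_2$, and $m$ any non-negative integer. Then $$k!\,S_{a_1,b_1}^{a_2,b_2,p_2}(p_1,k)=c_1^{ -p_1}c_2^{ -p_2}\sum_{j_1=0}^{p_1}\sum_{j_2=0}^{p_2}\binom{p_1}{j_1}\binom{p_2}{j_2}a_1^{j_1}a_2^{j_2}(b_1c_1-a_1c_1m-a_1d_1)^{p_1-j_1}(b_2c_2-a_2c_2m-a_2d_2)^{p_2-j_2}\sum_{t=0}^{m}\binom{m}{t}(k+t)!\,S_{c_1,d_1}^{c_2,d_2,j_2}(j_1,k+t).$$
   Context: For complex numbers $a_1,b_1,a_2,b_2$, non-negative integers $p_1,p_2$ and a non-negative integer $k$, the generalized Stirling number of the second kind is $$S_{a_1,b_1}^{a_2,b_2,p_2}(p_1,k)=\frac{1}{k!}\sum_{j=0}^{k}(-1)^j\binom{k}{j}\bigl(a_1(k-j)+b_1\bigr)^{p_1}\bigl(a_2(k-j)+b_2\bigr)^{p_2},$$ with $0^0=1$; it vanishes for $k>p_1+p_2$. -}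

module Defs where

open import Level using (Level)
open import Data.Nat as ℕ using (ℕ; zero; suc; _∸_)
open import Data.Nat.Combinatorics using (_C_)
open import Algebra.Bundles using (CommutativeRing; Semiring)

-- Everything is stated over an arbitrary commutative ring R
-- (the paper works over ℂ, which agda-stdlib does not provide).
module Gen {c ℓ : Level} (R : CommutativeRing c ℓ) where
  open CommutativeRing R hiding (zero)
  open import Algebra.Definitions.RawSemiring (Semiring.rawSemiring semiring) public using (_^_; _×_)

  ⟦_⟧ : ℕ → Carrier
  ⟦ n ⟧ = n × 1#

  Σ≤ : ℕ → (ℕ → Carrier) → Carrier
  Σ≤ zero    f = f zero
  Σ≤ (suc n) f = Σ≤ n f + f (suc n)

  -- factS a₁ b₁ a₂ b₂ p₂ p₁ k  =  k! · S_{a₁,b₁}^{a₂,b₂,p₂}(p₁,k)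
  --   = Σ_{j=0}^{k} (-1)^j C(k,j) (a₁(k-j)+b₁)^{p₁} (a₂(k-j)+b₂)^{p₂}
  -- (the definition of S with the factor 1/k! cleared; 0^0 = 1 holds
  -- since x ^ 0 = 1#).
  factS : Carrier → Carrier → Carrier → Carrier → ℕ → ℕ → ℕ → Carrier
  factS a₁ b₁ a₂ b₂ p₂ p₁ k =
    Σ≤ k (λ j → ((- 1#) ^ j) * (⟦ k C j ⟧ *
      (((a₁ * ⟦ k ∸ j ⟧ + b₁) ^ p₁) * ((a₂ * ⟦ k ∸ j ⟧ + b₂) ^ p₂))))

module Submission where

-- Clearing the factor 1/k!, k! S(p₁, k) is the k-th forward difference at 0 of
-- f x = (a₁ x + b₁)^p₁ (a₂ x + b₂)^p₂. Writing a x + b = c⁻¹ (a (c (x + m) + d) + (b c - a c m - a d))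
-- and expanding binomially makes f a linear combination of the shifted functions
-- x ↦ (c₁ (x + m) + d₁)^j₁ (c₂ (x + m) + d₂)^j₂. The difference operator is linear, and the
-- shift by m is (1 + Δ)^m, so Δᵏ (g (· + m)) = Σₜ C(m, t) Δᵏ⁺ᵗ g; for these g the right-hand
-- differences are exactly the factorial Stirling numbers S_{c₁,d₁}^{c₂,d₂,j₂}(j₁, k + t).

open import Defs
open import Data.Nat using (ℕ; _≤_; _∸_)
open import Data.Nat.Combinatorics using (_C_)
open import Algebra.Bundles using (CommutativeRing)

open import Level using (Level)
open import Data.Nat as ℕ using (zero; suc; z≤n)
open import Data.Nat.Properties as ℕₚ using (m≤n⇒m≤1+n; ≤-refl; n<1+n; +-∸-assoc)
open import Data.Nat.Combinatorics using (nCk+nC[k+1]≡[n+1]C[k+1]; k>n⇒nCk≡0)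
open import Data.Fin using (toℕ)
open import Data.Vec.Functional using (Vector; init; last)
open import Data.Fin.Properties using (toℕ-inject₁; toℕ-fromℕ)
import Relation.Binary.PropositionalEquality as ≡

module FiniteDifferences {c ℓ : Level} (R : CommutativeRing c ℓ) where
  open CommutativeRing R hiding (zero)
  open Gen R
  open import Relation.Binary.Reasoning.Setoid setoid
  open import Algebra.Properties.Ring ring using (-1*x≈-x)
  open import Algebra.Properties.Group +-group using (//-rightDividesˡ)
  open import Algebra.Properties.AbelianGroup +-abelianGroup using (⁻¹-∙-comm)
  open import Algebra.Properties.CommutativeSemigroup +-commutativeSemigroup
    using () renaming (interchange to +-interchange)
  open import Algebra.Properties.CommutativeSemigroup *-commutativeSemigroup
    using () renaming (x∙yz≈y∙xz to x*[y*z]≈y*[x*z]; interchange to *-interchange)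
  open import Algebra.Properties.Semiring.Sum semiring using (sum; sum-syntax; sum-init-last; sum-cong-≗)
  open import Algebra.Properties.Semiring.Mult semiring using (×-homo-+; ×-homo-1; ×-assoc-*; ×-congʳ)
  open import Algebra.Properties.Semiring.Exp semiring using (^-congˡ)
  open import Algebra.Properties.CommutativeSemiring.Exp commutativeSemiring using (^-distrib-*)
  import Algebra.Properties.CommutativeSemiring.Binomial commutativeSemiring as Binomial
  open import Algebra.Solver.Ring.NaturalCoefficients.Default commutativeSemiring
    using (solve; _:=_; _:+_; _:*_)

  ⟦+⟧ : ∀ m n → ⟦ m ℕ.+ n ⟧ ≈ ⟦ m ⟧ + ⟦ n ⟧
  ⟦+⟧ m n = ×-homo-+ 1# m n

  ⟦⟧*≈× : ∀ n x → ⟦ n ⟧ * x ≈ n × x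
  ⟦⟧*≈× n x = trans (×-assoc-* n 1# x) (×-congʳ n (*-identityˡ x))

  Σ≤-cong-≤ : ∀ n {f g : ℕ → Carrier} → (∀ i → i ≤ n → f i ≈ g i) → Σ≤ n f ≈ Σ≤ n g
  Σ≤-cong-≤ zero    f≈g = f≈g 0 z≤n
  Σ≤-cong-≤ (suc n) f≈g =
    +-cong (Σ≤-cong-≤ n (λ i i≤n → f≈g i (m≤n⇒m≤1+n i≤n))) (f≈g (suc n) ≤-refl)

  Σ≤-cong : ∀ n {f g : ℕ → Carrier} → (∀ i → f i ≈ g i) → Σ≤ n f ≈ Σ≤ n g
  Σ≤-cong n f≈g = Σ≤-cong-≤ n (λ i _ → f≈g i)

  Σ≤-distrib-+ : ∀ n (f g : ℕ → Carrier) → Σ≤ n (λ i → f i + g i) ≈ Σ≤ n f + Σ≤ n g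
  Σ≤-distrib-+ zero    f g = refl
  Σ≤-distrib-+ (suc n) f g = trans (+-congʳ (Σ≤-distrib-+ n f g)) (+-interchange _ _ _ _)

  Σ≤-distrib-neg : ∀ n (f : ℕ → Carrier) → Σ≤ n (λ i → - f i) ≈ - Σ≤ n f
  Σ≤-distrib-neg zero    f = refl
  Σ≤-distrib-neg (suc n) f = trans (+-congʳ (Σ≤-distrib-neg n f)) (⁻¹-∙-comm _ _)

  *-distribˡ-Σ≤ : ∀ n x (f : ℕ → Carrier) → x * Σ≤ n f ≈ Σ≤ n (λ i → x * f i)
  *-distribˡ-Σ≤ zero    x f = refl
  *-distribˡ-Σ≤ (suc n) x f = trans (distribˡ x _ _) (+-congʳ (*-distribˡ-Σ≤ n x f))

  *-distribʳ-Σ≤ : ∀ n x (f : ℕ → Carrier) → Σ≤ n f * x ≈ Σ≤ n (λ i → f i * x)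
  *-distribʳ-Σ≤ zero    x f = refl
  *-distribʳ-Σ≤ (suc n) x f = trans (distribʳ x _ _) (+-congʳ (*-distribʳ-Σ≤ n x f))

  Σ≤-*-Σ≤ : ∀ n m (f g : ℕ → Carrier) →
    Σ≤ n f * Σ≤ m g ≈ Σ≤ n (λ i → Σ≤ m (λ j → f i * g j))
  Σ≤-*-Σ≤ n m f g = trans (*-distribʳ-Σ≤ n _ f) (Σ≤-cong n (λ i → *-distribˡ-Σ≤ m (f i) g))

  Σ≤-comm : ∀ n m (F : ℕ → ℕ → Carrier) →
    Σ≤ n (λ i → Σ≤ m (λ j → F i j)) ≈ Σ≤ m (λ j → Σ≤ n (λ i → F i j))
  Σ≤-comm zero    m F = refl
  Σ≤-comm (suc n) m F = trans (+-congʳ (Σ≤-comm n m F)) (sym (Σ≤-distrib-+ m _ _))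

  Σ≤-split-head : ∀ n (f : ℕ → Carrier) → Σ≤ (suc n) f ≈ f 0 + Σ≤ n (λ i → f (suc i))
  Σ≤-split-head zero    f = refl
  Σ≤-split-head (suc n) f = trans (+-congʳ (Σ≤-split-head n f)) (+-assoc _ _ _)

  Σ≤≈∑ : ∀ n (f : ℕ → Carrier) → Σ≤ n f ≈ ∑[ i < suc n ] f (toℕ i)
  Σ≤≈∑ zero    f = sym (+-identityʳ (f 0))
  Σ≤≈∑ (suc n) f = begin
    Σ≤ n f + f (suc n)
      ≈⟨ +-congʳ (Σ≤≈∑ n f) ⟩
    ∑[ i < suc n ] f (toℕ i) + f (suc n)
      ≈⟨ +-cong (reflexive (sum-cong-≗ {suc n} (λ i → ≡.cong f (≡.sym (toℕ-inject₁ i)))))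
                (reflexive (≡.cong f (≡.sym (toℕ-fromℕ (suc n))))) ⟩
    sum (init t) + last t
      ≈⟨ sum-init-last t ⟨
    ∑[ i < suc (suc n) ] f (toℕ i) ∎
    where
      t : Vector Carrier (suc (suc n))
      t i = f (toℕ i)

  Σ≤-pascal : ∀ m (u : ℕ → Carrier) →
    Σ≤ (suc m) (λ t → ⟦ suc m C t ⟧ * u t)
      ≈ Σ≤ m (λ t → ⟦ m C t ⟧ * u t) + Σ≤ m (λ t → ⟦ m C t ⟧ * u (suc t))
  Σ≤-pascal m u = begin
    Σ≤ (suc m) (λ t → ⟦ suc m C t ⟧ * u t)
      ≈⟨ Σ≤-split-head m _ ⟩
    ⟦ m C 0 ⟧ * u 0 + Σ≤ m (λ t → ⟦ suc m C suc t ⟧ * u (suc t))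
      ≈⟨ +-congˡ (trans (Σ≤-cong m pascal-term) (Σ≤-distrib-+ m _ _)) ⟩
    ⟦ m C 0 ⟧ * u 0 + (Σ≤ m (λ t → ⟦ m C t ⟧ * u (suc t)) + Σ≤ m (λ t → ⟦ m C suc t ⟧ * u (suc t)))
      ≈⟨ +-congˡ (+-comm _ _) ⟩
    ⟦ m C 0 ⟧ * u 0 + (Σ≤ m (λ t → ⟦ m C suc t ⟧ * u (suc t)) + Σ≤ m (λ t → ⟦ m C t ⟧ * u (suc t)))
      ≈⟨ trans (+-congʳ (Σ≤-split-head m _)) (+-assoc _ _ _) ⟨
    Σ≤ (suc m) (λ t → ⟦ m C t ⟧ * u t) + Σ≤ m (λ t → ⟦ m C t ⟧ * u (suc t))
      ≈⟨ +-congʳ (trans (+-congˡ top-vanishes) (+-identityʳ _)) ⟩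
    Σ≤ m (λ t → ⟦ m C t ⟧ * u t) + Σ≤ m (λ t → ⟦ m C t ⟧ * u (suc t)) ∎
    where
      pascal-term : ∀ t → ⟦ suc m C suc t ⟧ * u (suc t)
                          ≈ ⟦ m C t ⟧ * u (suc t) + ⟦ m C suc t ⟧ * u (suc t)
      pascal-term t = begin
        ⟦ suc m C suc t ⟧ * u (suc t)
          ≡⟨ ≡.cong (λ n → ⟦ n ⟧ * u (suc t)) (nCk+nC[k+1]≡[n+1]C[k+1] m t) ⟨
        ⟦ m C t ℕ.+ m C suc t ⟧ * u (suc t)
          ≈⟨ trans (*-congʳ (⟦+⟧ (m C t) (m C suc t))) (distribʳ _ _ _) ⟩
        ⟦ m C t ⟧ * u (suc t) + ⟦ m C suc t ⟧ * u (suc t) ∎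
      top-vanishes : ⟦ m C suc m ⟧ * u (suc m) ≈ 0#
      top-vanishes = trans (*-congʳ (reflexive (≡.cong ⟦_⟧ (k>n⇒nCk≡0 (n<1+n m))))) (zeroˡ _)

  binomial : ∀ p x y → (x + y) ^ p ≈ Σ≤ p (λ j → ⟦ p C j ⟧ * (x ^ j * y ^ (p ∸ j)))
  binomial p x y = begin
    (x + y) ^ p                                                ≈⟨ Binomial.theorem p x y ⟩
    ∑[ j < suc p ] ((p C toℕ j) × (x ^ toℕ j * y ^ (p ∸ toℕ j))) ≈⟨ Σ≤≈∑ p _ ⟨
    Σ≤ p (λ j → (p C j) × (x ^ j * y ^ (p ∸ j)))                ≈⟨ Σ≤-cong p (λ j → ⟦⟧*≈× (p C j) _) ⟨
    Σ≤ p (λ j → ⟦ p C j ⟧ * (x ^ j * y ^ (p ∸ j)))              ∎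

  -- The k-th forward difference of g at 0; factS a₁ b₁ a₂ b₂ p₂ p₁ k is by definition
  -- Δ k (λ x → (a₁ * ⟦ x ⟧ + b₁) ^ p₁ * (a₂ * ⟦ x ⟧ + b₂) ^ p₂).
  Δ : ℕ → (ℕ → Carrier) → Carrier
  Δ k g = Σ≤ k (λ j → (- 1#) ^ j * (⟦ k C j ⟧ * g (k ∸ j)))

  Δ-cong : ∀ k {f g : ℕ → Carrier} → (∀ x → f x ≈ g x) → Δ k f ≈ Δ k g
  Δ-cong k f≈g = Σ≤-cong k (λ j → *-congˡ (*-congˡ (f≈g (k ∸ j))))

  Δ-*ˡ : ∀ k a (g : ℕ → Carrier) → Δ k (λ x → a * g x) ≈ a * Δ k g
  Δ-*ˡ k a g = begin
    Σ≤ k (λ j → (- 1#) ^ j * (⟦ k C j ⟧ * (a * g (k ∸ j))))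
      ≈⟨ Σ≤-cong k (λ j → trans (*-congˡ (x*[y*z]≈y*[x*z] _ a _)) (x*[y*z]≈y*[x*z] _ a _)) ⟩
    Σ≤ k (λ j → a * ((- 1#) ^ j * (⟦ k C j ⟧ * g (k ∸ j))))
      ≈⟨ *-distribˡ-Σ≤ k a _ ⟨
    a * Δ k g ∎

  Δ-Σ≤ : ∀ k n (h : ℕ → ℕ → Carrier) →
    Δ k (λ x → Σ≤ n (λ i → h i x)) ≈ Σ≤ n (λ i → Δ k (h i))
  Δ-Σ≤ k n h = trans
    (Σ≤-cong k (λ j → trans (*-congˡ (*-distribˡ-Σ≤ n _ _)) (*-distribˡ-Σ≤ n _ _)))
    (Σ≤-comm k n _)

  Δ-suc : ∀ k (g : ℕ → Carrier) → Δ (suc k) g ≈ Δ k (λ x → g (suc x)) - Δ k g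
  Δ-suc k g = begin
    Δ (suc k) g
      ≈⟨ Σ≤-cong (suc k) (λ j → x*[y*z]≈y*[x*z] _ _ _) ⟩
    Σ≤ (suc k) (λ j → ⟦ suc k C j ⟧ * ((- 1#) ^ j * g (suc k ∸ j)))
      ≈⟨ Σ≤-pascal k _ ⟩
    Σ≤ k (λ j → ⟦ k C j ⟧ * ((- 1#) ^ j * g (suc k ∸ j)))
      + Σ≤ k (λ j → ⟦ k C j ⟧ * ((- 1#) ^ suc j * g (k ∸ j)))
      ≈⟨ +-cong (Σ≤-cong-≤ k shifted) (trans (Σ≤-cong k negated) (Σ≤-distrib-neg k _)) ⟩
    Δ k (λ x → g (suc x)) - Δ k g ∎
    where
      shifted : ∀ j → j ≤ k → ⟦ k C j ⟧ * ((- 1#) ^ j * g (suc k ∸ j))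
                               ≈ (- 1#) ^ j * (⟦ k C j ⟧ * g (suc (k ∸ j)))
      shifted j j≤k =
        trans (x*[y*z]≈y*[x*z] _ _ _) (*-congˡ (*-congˡ (reflexive (≡.cong g (+-∸-assoc 1 j≤k)))))
      negated : ∀ j → ⟦ k C j ⟧ * ((- 1#) ^ suc j * g (k ∸ j))
                       ≈ - ((- 1#) ^ j * (⟦ k C j ⟧ * g (k ∸ j)))
      negated j = trans (solve 4 (λ C s t y → C :* ((s :* t) :* y) := s :* (t :* (C :* y))) refl _ _ _ _)
                        (-1*x≈-x _)

  Δ-∘suc : ∀ k (g : ℕ → Carrier) → Δ k (λ x → g (suc x)) ≈ Δ (suc k) g + Δ k g
  Δ-∘suc k g = sym (trans (+-congʳ (Δ-suc k g)) (//-rightDividesˡ _ _))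

  Δ-shift : ∀ m k (g : ℕ → Carrier) →
    Δ k (λ x → g (x ℕ.+ m)) ≈ Σ≤ m (λ t → ⟦ m C t ⟧ * Δ (k ℕ.+ t) g)
  Δ-shift zero k g = begin
    Δ k (λ x → g (x ℕ.+ 0))  ≈⟨ Δ-cong k (λ x → reflexive (≡.cong g (ℕₚ.+-identityʳ x))) ⟩
    Δ k g                    ≡⟨ ≡.cong (λ n → Δ n g) (ℕₚ.+-identityʳ k) ⟨
    Δ (k ℕ.+ 0) g            ≈⟨ trans (⟦⟧*≈× 1 _) (×-homo-1 _) ⟨
    ⟦ 0 C 0 ⟧ * Δ (k ℕ.+ 0) g ∎
  Δ-shift (suc m) k g = begin
    Δ k (λ x → g (x ℕ.+ suc m))
      ≈⟨ Δ-cong k (λ x → reflexive (≡.cong g (ℕₚ.+-suc x m))) ⟩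
    Δ k (λ x → g (suc (x ℕ.+ m)))
      ≈⟨ Δ-shift m k (λ y → g (suc y)) ⟩
    Σ≤ m (λ t → ⟦ m C t ⟧ * Δ (k ℕ.+ t) (λ y → g (suc y)))
      ≈⟨ trans (Σ≤-cong m split) (Σ≤-distrib-+ m _ _) ⟩
    Σ≤ m (λ t → ⟦ m C t ⟧ * Δ (k ℕ.+ t) g) + Σ≤ m (λ t → ⟦ m C t ⟧ * Δ (k ℕ.+ suc t) g)
      ≈⟨ Σ≤-pascal m (λ t → Δ (k ℕ.+ t) g) ⟨
    Σ≤ (suc m) (λ t → ⟦ suc m C t ⟧ * Δ (k ℕ.+ t) g) ∎
    where
      split : ∀ t → ⟦ m C t ⟧ * Δ (k ℕ.+ t) (λ y → g (suc y))
                     ≈ ⟦ m C t ⟧ * Δ (k ℕ.+ t) g + ⟦ m C t ⟧ * Δ (k ℕ.+ suc t) g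
      split t = begin
        ⟦ m C t ⟧ * Δ (k ℕ.+ t) (λ y → g (suc y))
          ≈⟨ *-congˡ (trans (Δ-∘suc (k ℕ.+ t) g) (+-comm _ _)) ⟩
        ⟦ m C t ⟧ * (Δ (k ℕ.+ t) g + Δ (suc (k ℕ.+ t)) g)
          ≡⟨ ≡.cong (λ n → ⟦ m C t ⟧ * (Δ (k ℕ.+ t) g + Δ n g)) (ℕₚ.+-suc k t) ⟨
        ⟦ m C t ⟧ * (Δ (k ℕ.+ t) g + Δ (k ℕ.+ suc t) g)
          ≈⟨ distribˡ _ _ _ ⟩
        ⟦ m C t ⟧ * Δ (k ℕ.+ t) g + ⟦ m C t ⟧ * Δ (k ℕ.+ suc t) g ∎

  -- The solver only proves semiring identities, so the subtracted block is kept abstract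
  -- and its subtractions are cancelled by hand.
  recentre : ∀ a b c d X M →
    c * (a * X + b) ≈ a * (c * (X + M) + d) + (b * c - a * c * M - a * d)
  recentre a b c d X M = sym (begin
    a * (c * (X + M) + d) + (b * c - a * c * M - a * d)
      ≈⟨ solve 7 (λ a c d X M b B → a :* (c :* (X :+ M) :+ d) :+ B
                                     := a :* c :* X :+ ((B :+ a :* d) :+ a :* c :* M)) refl a c d X M b _ ⟩
    a * c * X + ((b * c - a * c * M - a * d + a * d) + a * c * M)
      ≈⟨ +-congˡ (trans (+-congʳ (//-rightDividesˡ _ _)) (//-rightDividesˡ _ _)) ⟩
    a * c * X + b * c
      ≈⟨ solve 4 (λ a b c X → a :* c :* X :+ b :* c := c :* (a :* X :+ b)) refl a b c X ⟩
    c * (a * X + b) ∎)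

  recentredCoefficient : (a b c d : Carrier) (m p j : ℕ) → Carrier
  recentredCoefficient a b c d m p j =
    ⟦ p C j ⟧ * (a ^ j * (b * c - a * c * ⟦ m ⟧ - a * d) ^ (p ∸ j))

  affine-binomial : ∀ {c c⁻¹} → c * c⁻¹ ≈ 1# → ∀ a b d p m x →
    (a * ⟦ x ⟧ + b) ^ p
      ≈ c⁻¹ ^ p * Σ≤ p (λ j → recentredCoefficient a b c d m p j * (c * ⟦ x ℕ.+ m ⟧ + d) ^ j)
  affine-binomial {c} {c⁻¹} cc⁻¹≈1 a b d p m x = begin
    (a * ⟦ x ⟧ + b) ^ p          ≈⟨ ^-congˡ p (trans (*-congˡ (sym recentred)) c⁻¹[cz]≈z) ⟨
    (c⁻¹ * (a * Y + B)) ^ p      ≈⟨ ^-distrib-* c⁻¹ _ p ⟩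
    c⁻¹ ^ p * (a * Y + B) ^ p    ≈⟨ *-congˡ (binomial p (a * Y) B) ⟩
    c⁻¹ ^ p * Σ≤ p (λ j → ⟦ p C j ⟧ * ((a * Y) ^ j * B ^ (p ∸ j)))
      ≈⟨ *-congˡ (Σ≤-cong p (λ j → trans (*-congˡ (*-congʳ (^-distrib-* a Y j))) (regroup _ _ _ _))) ⟩
    c⁻¹ ^ p * Σ≤ p (λ j → (⟦ p C j ⟧ * (a ^ j * B ^ (p ∸ j))) * Y ^ j) ∎
    where
      Y B : Carrier
      Y = c * ⟦ x ℕ.+ m ⟧ + d
      B = b * c - a * c * ⟦ m ⟧ - a * d
      recentred : c * (a * ⟦ x ⟧ + b) ≈ a * Y + B
      recentred = trans (recentre a b c d ⟦ x ⟧ ⟦ m ⟧)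
                        (+-congʳ (*-congˡ (+-congʳ (*-congˡ (sym (⟦+⟧ x m))))))
      c⁻¹[cz]≈z : ∀ {z} → c⁻¹ * (c * z) ≈ z
      c⁻¹[cz]≈z {z} = trans (sym (*-assoc c⁻¹ c z))
                            (trans (*-congʳ (trans (*-comm c⁻¹ c) cc⁻¹≈1)) (*-identityˡ z))
      regroup : ∀ C A U V → C * ((A * U) * V) ≈ (C * (A * V)) * U
      regroup = solve 4 (λ C A U V → C :* ((A :* U) :* V) := (C :* (A :* V)) :* U) refl

  affine-binomial-* : ∀ {c₁ c₁⁻¹ c₂ c₂⁻¹} → c₁ * c₁⁻¹ ≈ 1# → c₂ * c₂⁻¹ ≈ 1# →
    ∀ a₁ b₁ d₁ a₂ b₂ d₂ p₁ p₂ m x →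
    (a₁ * ⟦ x ⟧ + b₁) ^ p₁ * (a₂ * ⟦ x ⟧ + b₂) ^ p₂
      ≈ c₁⁻¹ ^ p₁ * (c₂⁻¹ ^ p₂ * Σ≤ p₁ (λ j₁ → Σ≤ p₂ (λ j₂ →
          (recentredCoefficient a₁ b₁ c₁ d₁ m p₁ j₁ * recentredCoefficient a₂ b₂ c₂ d₂ m p₂ j₂)
          * ((c₁ * ⟦ x ℕ.+ m ⟧ + d₁) ^ j₁ * (c₂ * ⟦ x ℕ.+ m ⟧ + d₂) ^ j₂))))
  affine-binomial-* c₁c₁⁻¹≈1 c₂c₂⁻¹≈1 a₁ b₁ d₁ a₂ b₂ d₂ p₁ p₂ m x =
    trans (*-cong (affine-binomial c₁c₁⁻¹≈1 a₁ b₁ d₁ p₁ m x) (affine-binomial c₂c₂⁻¹≈1 a₂ b₂ d₂ p₂ m x))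
   (trans (trans (*-interchange _ _ _ _) (*-assoc _ _ _))
          (*-congˡ (*-congˡ (trans (Σ≤-*-Σ≤ p₁ p₂ _ _)
                                   (Σ≤-cong p₁ (λ j₁ → Σ≤-cong p₂ (λ j₂ → *-interchange _ _ _ _)))))))

  Δ-Σ≤²-shift : ∀ k m p q (w : ℕ → ℕ → Carrier) (G : ℕ → ℕ → ℕ → Carrier) →
    Δ k (λ x → Σ≤ p (λ i → Σ≤ q (λ j → w i j * G i j (x ℕ.+ m))))
      ≈ Σ≤ p (λ i → Σ≤ q (λ j → w i j * Σ≤ m (λ t → ⟦ m C t ⟧ * Δ (k ℕ.+ t) (G i j))))
  Δ-Σ≤²-shift k m p q w G =
    trans (Δ-Σ≤ k p (λ i x → Σ≤ q (λ j → w i j * G i j (x ℕ.+ m)))) (Σ≤-cong p (λ i →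
    trans (Δ-Σ≤ k q (λ j x → w i j * G i j (x ℕ.+ m))) (Σ≤-cong q (λ j →
    trans (Δ-*ˡ k (w i j) (λ x → G i j (x ℕ.+ m))) (*-congˡ (Δ-shift m k (G i j)))))))

proposition1 : ∀ {c ℓ} (R : CommutativeRing c ℓ) →
    let open CommutativeRing R
        open Gen R
    in (a₁ b₁ a₂ b₂ d₁ d₂ c₁ c₂ c₁⁻¹ c₂⁻¹ : Carrier) →
       c₁ * c₁⁻¹ ≈ 1# → c₂ * c₂⁻¹ ≈ 1# →
       (p₁ p₂ k : ℕ) → k ≤ Data.Nat._+_ p₁ p₂ → (m : ℕ) →
       factS a₁ b₁ a₂ b₂ p₂ p₁ k
         ≈ (c₁⁻¹ ^ p₁) * ((c₂⁻¹ ^ p₂) *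
             Σ≤ p₁ (λ j₁ → Σ≤ p₂ (λ j₂ →
               ⟦ p₁ C j₁ ⟧ * (⟦ p₂ C j₂ ⟧ * ((a₁ ^ j₁) * ((a₂ ^ j₂) *
               (((b₁ * c₁ - a₁ * c₁ * ⟦ m ⟧ - a₁ * d₁) ^ (p₁ ∸ j₁)) *
               (((b₂ * c₂ - a₂ * c₂ * ⟦ m ⟧ - a₂ * d₂) ^ (p₂ ∸ j₂)) *
               Σ≤ m (λ t → ⟦ m C t ⟧ *
                 factS c₁ d₁ c₂ d₂ j₂ j₁ (Data.Nat._+_ k t))))))))))
proposition1 R a₁ b₁ a₂ b₂ d₁ d₂ c₁ c₂ c₁⁻¹ c₂⁻¹ c₁c₁⁻¹≈1 c₂c₂⁻¹≈1 p₁ p₂ k _ m = begin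
  Δ k (λ x → (a₁ * ⟦ x ⟧ + b₁) ^ p₁ * (a₂ * ⟦ x ⟧ + b₂) ^ p₂)
    ≈⟨ Δ-cong k (affine-binomial-* c₁c₁⁻¹≈1 c₂c₂⁻¹≈1 a₁ b₁ d₁ a₂ b₂ d₂ p₁ p₂ m) ⟩
  Δ k (λ x → c₁⁻¹ ^ p₁ * (c₂⁻¹ ^ p₂ * T x))
    ≈⟨ trans (Δ-*ˡ k _ (λ x → c₂⁻¹ ^ p₂ * T x)) (*-congˡ (Δ-*ˡ k _ T)) ⟩
  c₁⁻¹ ^ p₁ * (c₂⁻¹ ^ p₂ * Δ k T)
    ≈⟨ *-congˡ (*-congˡ (trans (Δ-Σ≤²-shift k m p₁ p₂ w G)
                               (Σ≤-cong p₁ (λ j₁ → Σ≤-cong p₂ (λ j₂ → reassociate _ _ _ _ _ _ _))))) ⟩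
  _ ∎
  where
    open CommutativeRing R
    open Gen R
    open FiniteDifferences R
    open import Relation.Binary.Reasoning.Setoid setoid
    open import Algebra.Solver.Ring.NaturalCoefficients.Default commutativeSemiring
      using (solve; _:=_; _:*_)

    w : ℕ → ℕ → Carrier
    w j₁ j₂ = recentredCoefficient a₁ b₁ c₁ d₁ m p₁ j₁ * recentredCoefficient a₂ b₂ c₂ d₂ m p₂ j₂

    G : ℕ → ℕ → ℕ → Carrier
    G j₁ j₂ y = (c₁ * ⟦ y ⟧ + d₁) ^ j₁ * (c₂ * ⟦ y ⟧ + d₂) ^ j₂

    T : ℕ → Carrier
    T x = Σ≤ p₁ (λ j₁ → Σ≤ p₂ (λ j₂ → w j₁ j₂ * G j₁ j₂ (x ℕ.+ m)))

    reassociate : ∀ C₁ A₁ P₁ C₂ A₂ P₂ S →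
      (C₁ * (A₁ * P₁)) * (C₂ * (A₂ * P₂)) * S ≈ C₁ * (C₂ * (A₁ * (A₂ * (P₁ * (P₂ * S)))))
    reassociate = solve 7 (λ C₁ A₁ P₁ C₂ A₂ P₂ S →
      (C₁ :* (A₁ :* P₁)) :* (C₂ :* (A₂ :* P₂)) :* S := C₁ :* (C₂ :* (A₁ :* (A₂ :* (P₁ :* (P₂ :* S)))))) refl
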